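{- Let $q$ be a prime power, $n$ a positive integer coprime to $q$, $\gamma\in\mathbb{Z}/n\mathbb{Z}$ and $\tau=|c_{n/q}(\gamma)|$. Then $c_{n/q}(\gamma)$ is of equal difference if and only if (i) $\tau\mid n$ and (ii) $\gamma q\equiv\gamma\pmod{n/\tau}$.
   Context: $c_{n/q}(\gamma)=\{\gamma,\gamma q,\dots,\gamma q^{\tau-1}\}\subseteq\mathbb{Z}/n\mathbb{Z}$ with $\tau$ least positive such that $\gamma q^\tau\equiv\gamma\pmod n$. The coset is of equal difference if $\tau\mid n$ and $c_{n/q}(\gamma)=\{\gamma,\gamma+\frac n\tau,\dots,\gamma+(\tau-1)\frac n\tau\}$ in $\mathbb{Z}/n\mathbb{Z}$; one-element cosets are regarded as of equal difference. -}

module Defs where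

open import Data.Nat using (ℕ; _*_; _+_; _^_; _<_; _≤_; NonZero; _/_)
open import Data.Nat.Divisibility using () renaming (_∣_ to _∣ℕ_)
open import Data.Nat.Primality using (Prime)
open import Data.Integer using (ℤ; +_; _-_)
open import Data.Integer.Divisibility using () renaming (_∣_ to _∣ℤ_)
open import Data.Product using (_×_; ∃-syntax)
open import Relation.Binary.PropositionalEquality using (_≡_)
open import Relation.Nullary using (¬_)
open import Function.Bundles using (_⇔_)

_≡_[mod_] : ℕ → ℕ → ℕ → Set
a ≡ b [mod m ] = (+ m) ∣ℤ ((+ a) - (+ b))

IsPrimePower : ℕ → Set
IsPrimePower q = ∃[ p ] ∃[ k ] (Prime p × 1 ≤ k × q ≡ p ^ k)

-- τ is the least positive integer with γ q^τ ≡ γ (mod n),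
-- i.e. τ = |c_{n/q}(γ)|.
IsCosetSize : (n q γ τ : ℕ) → Set
IsCosetSize n q γ τ =
  1 ≤ τ × (γ * q ^ τ) ≡ γ [mod n ] ×
  (∀ t → 1 ≤ t → t < τ → ¬ ((γ * q ^ t) ≡ γ [mod n ]))

InCoset : (n q γ τ x : ℕ) → Set
InCoset n q γ τ x = ∃[ i ] (i < τ × x ≡ (γ * q ^ i) [mod n ])

InProgression : (n γ τ : ℕ) .{{_ : NonZero τ}} (x : ℕ) → Set
InProgression n γ τ x = ∃[ j ] (j < τ × x ≡ (γ + j * (n / τ)) [mod n ])

-- c_{n/q}(γ) (with τ = its size) is of equal difference:
-- τ ∣ n and, as subsets of ℤ/nℤ, c_{n/q}(γ) = {γ + j n/τ : 0 ≤ j < τ}.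
-- (One-element cosets satisfy this automatically.)
EqualDifference : (n q γ τ : ℕ) .{{_ : NonZero τ}} → Set
EqualDifference n q γ τ =
  τ ∣ℕ n × (∀ x → InCoset n q γ τ x ⇔ InProgression n γ τ x)

{-# OPTIONS --safe #-}
module Submission where

-- If the coset is an arithmetic progression with difference n/τ, then γq, which lies in it
-- (or equals γ mod n when τ = 1), is congruent to γ modulo n/τ. Conversely, if γq ≡ γ
-- (mod n/τ), then every γqⁱ ≡ γ (mod n/τ), so γqⁱ ≡ γ + rᵢ·n/τ (mod n) for some rᵢ < τ.
-- As q is invertible mod n and τ is the least period, the γqⁱ (i < τ) are distinct mod n;
-- hence i ↦ rᵢ is injective, thus bijective, on {0, …, τ-1}, and the two sets coincide.

open import Defs
open import Level using (0ℓ)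
open import Data.Nat using (ℕ; zero; suc; _+_; _*_; _^_; _∸_; _<_; z<s; s<s; NonZero; _/_)
open import Data.Nat.Properties
  using (*-comm; *-assoc; *-identityˡ; *-identityʳ; *-commutativeSemigroup; ^-distribˡ-+-*;
         <-cmp; <⇒≤; ≤-<-trans; 1+n≰n; m∸n≤m; m+[n∸m]≡n; m<n⇒0<n∸m)
open import Algebra.Properties.CommutativeSemigroup *-commutativeSemigroup using (x∙yz≈y∙xz)
open import Data.Nat.Divisibility using (_∣_; divides; _∣0; ∣-trans; m/n∣m)
open import Data.Nat.DivMod using (m*[n/m]≡n)
open import Data.Nat.Coprimality using (Coprime; coprime-divisor)
open import Data.Integer as ℤ using (+_; _%ℕ_; _/ℕ_)
import Data.Integer.Properties as ℤ
open import Data.Integer.DivMod using (n%ℕd<d; a≡a%ℕn+[a/ℕn]*n)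
import Data.Integer.Divisibility.Signed as ℤˢ
open import Data.Integer.Tactic.RingSolver using (solve-∀)
open import Data.Fin using (Fin; toℕ; fromℕ<; punchOut)
open import Data.Fin.Properties
  using (any?; _≟_; punchOut-injective; injective⇒≤; toℕ-fromℕ<; toℕ<n; toℕ-injective)
open import Data.Product using (_×_; ∃-syntax; _,_; proj₁; proj₂)
open import Function.Base using (_∘_)
open import Function.Bundles using (_⇔_; mk⇔; Equivalence)
open import Function.Definitions using (Injective)
open import Relation.Binary.Bundles using (Setoid)
open import Relation.Binary.Definitions using (tri<; tri≈; tri>)
import Relation.Binary.Reasoning.Setoid as SetoidReasoning
open import Relation.Binary.PropositionalEquality
  using (_≡_; _≢_; refl; sym; trans; cong; cong₂; subst; module ≡-Reasoning)
open import Relation.Nullary using (¬_; yes; no; contradiction)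

-- a ≡ b [mod m ] unfolds to m ∣ ℤ.∣ + a ℤ.- + b ∣, from which Agda cannot infer a and b;
-- so they are explicit arguments below, and congruence chains use setoid reasoning.

private
  toSigned : ∀ {m} a b → a ≡ b [mod m ] → + m ℤˢ.∣ (+ a ℤ.- + b)
  toSigned _ _ = ℤˢ.∣ᵤ⇒∣

  fromSigned : ∀ {m} a b → + m ℤˢ.∣ (+ a ℤ.- + b) → a ≡ b [mod m ]
  fromSigned _ _ = ℤˢ.∣⇒∣ᵤ

  pos-+-* : ∀ a j m → + (a + j * m) ≡ + a ℤ.+ + j ℤ.* + m
  pos-+-* a j m = trans (ℤ.pos-+ a (j * m)) (cong (ℤ._+_ (+ a)) (ℤ.pos-* j m))

  ∣diff∣-*ˡ : ∀ k a b → ℤ.∣ + (k * a) ℤ.- + (k * b) ∣ ≡ k * ℤ.∣ + a ℤ.- + b ∣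
  ∣diff∣-*ˡ k a b = begin
    ℤ.∣ + (k * a) ℤ.- + (k * b) ∣      ≡⟨ cong ℤ.∣_∣ (cong₂ ℤ._-_ (ℤ.pos-* k a) (ℤ.pos-* k b)) ⟩
    ℤ.∣ + k ℤ.* + a ℤ.- + k ℤ.* + b ∣  ≡⟨ cong ℤ.∣_∣ (factor (+ k) (+ a) (+ b)) ⟩
    ℤ.∣ + k ℤ.* (+ a ℤ.- + b) ∣        ≡⟨ ℤ.abs-* (+ k) (+ a ℤ.- + b) ⟩
    k * ℤ.∣ + a ℤ.- + b ∣              ∎
    where
    open ≡-Reasoning
    factor : ∀ x y z → x ℤ.* y ℤ.- x ℤ.* z ≡ x ℤ.* (y ℤ.- z)
    factor = solve-∀

≡-mod-refl : ∀ {m} a → a ≡ a [mod m ]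
≡-mod-refl {m} a = subst (m ∣_) (cong ℤ.∣_∣ (sym (ℤ.+-inverseʳ (+ a)))) (m ∣0)

≡-mod-reflexive : ∀ {m a b} → a ≡ b → a ≡ b [mod m ]
≡-mod-reflexive {a = a} refl = ≡-mod-refl a

≡-mod-sym : ∀ {m} a b → a ≡ b [mod m ] → b ≡ a [mod m ]
≡-mod-sym {m} a b a≡b = fromSigned b a
  (subst (+ m ℤˢ.∣_) (neg-diff (+ a) (+ b)) (ℤˢ.∣m⇒∣-m (toSigned a b a≡b)))
  where
  neg-diff : ∀ x y → ℤ.- (x ℤ.- y) ≡ y ℤ.- x
  neg-diff = solve-∀

≡-mod-trans : ∀ {m} a b c → a ≡ b [mod m ] → b ≡ c [mod m ] → a ≡ c [mod m ]
≡-mod-trans {m} a b c a≡b b≡c = fromSigned a c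
  (subst (+ m ℤˢ.∣_) (telescope (+ a) (+ b) (+ c))
    (ℤˢ.∣m∣n⇒∣m+n (toSigned a b a≡b) (toSigned b c b≡c)))
  where
  telescope : ∀ x y z → (x ℤ.- y) ℤ.+ (y ℤ.- z) ≡ x ℤ.- z
  telescope = solve-∀

≡-mod-setoid : ℕ → Setoid 0ℓ 0ℓ
≡-mod-setoid m = record
  { Carrier       = ℕ
  ; _≈_           = λ a b → a ≡ b [mod m ]
  ; isEquivalence = record
    { refl  = λ {a} → ≡-mod-refl a
    ; sym   = λ {a} {b} → ≡-mod-sym a b
    ; trans = λ {a} {b} {c} → ≡-mod-trans a b c
    }
  }

module ≡-mod-Reasoning (m : ℕ) = SetoidReasoning (≡-mod-setoid m)

≡-mod-*ˡ : ∀ {m} k a b → a ≡ b [mod m ] → (k * a) ≡ (k * b) [mod m ]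
≡-mod-*ˡ {m} k a b a≡b = subst (m ∣_) (sym (∣diff∣-*ˡ k a b)) (∣-trans a≡b (divides k refl))

≡-mod-∣ : ∀ {d m} a b → d ∣ m → a ≡ b [mod m ] → a ≡ b [mod d ]
≡-mod-∣ _ _ d∣m a≡b = ∣-trans d∣m a≡b

+-multiple-≡-mod : ∀ a j m → (a + j * m) ≡ a [mod m ]
+-multiple-≡-mod a j m = fromSigned (a + j * m) a (ℤˢ.divides (+ j) (begin
  + (a + j * m) ℤ.- + a        ≡⟨ cong (ℤ._- + a) (pos-+-* a j m) ⟩
  + a ℤ.+ + j ℤ.* + m ℤ.- + a  ≡⟨ cancel (+ a) (+ j ℤ.* + m) ⟩
  + j ℤ.* + m                  ∎))
  where
  open ≡-Reasoning
  cancel : ∀ x y → x ℤ.+ y ℤ.- x ≡ y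
  cancel = solve-∀

coprime-divisor-^ : ∀ {m n o} → Coprime m n → ∀ i → m ∣ n ^ i * o → m ∣ o
coprime-divisor-^ {m} {o = o} _ zero m∣1*o = subst (m ∣_) (*-identityˡ o) m∣1*o
coprime-divisor-^ {m} {n} {o} m⊥n (suc i) m∣nⁱ⁺¹*o =
  coprime-divisor-^ m⊥n i (coprime-divisor m⊥n (subst (m ∣_) (*-assoc n (n ^ i) o) m∣nⁱ⁺¹*o))

≡-mod-^-cancelˡ : ∀ {m q} → Coprime m q → ∀ i a b →
                  (q ^ i * a) ≡ (q ^ i * b) [mod m ] → a ≡ b [mod m ]
≡-mod-^-cancelˡ {m} {q} m⊥q i a b qⁱa≡qⁱb =
  coprime-divisor-^ m⊥q i (subst (m ∣_) (∣diff∣-*ˡ (q ^ i) a b) qⁱa≡qⁱb)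

≡-mod-refine : ∀ {n m τ} .{{_ : NonZero τ}} → n ≡ τ * m → ∀ a b → a ≡ b [mod m ] →
               ∃[ r ] (r < τ × a ≡ (b + r * m) [mod n ])
≡-mod-refine {n} {m} {τ} n≡τm a b a≡b with ℤˢ.divides k a-b≡km ← toSigned a b a≡b =
  r , n%ℕd<d k τ , fromSigned a (b + r * m) (ℤˢ.divides (k /ℕ τ) (begin
    + a ℤ.- + (b + r * m)                                ≡⟨ cong (ℤ._-_ (+ a)) (pos-+-* b r m) ⟩
    + a ℤ.- (+ b ℤ.+ + r ℤ.* + m)                        ≡⟨ regroup (+ a) (+ b) (+ r ℤ.* + m) ⟩
    (+ a ℤ.- + b) ℤ.- + r ℤ.* + m                        ≡⟨ cong (ℤ._- + r ℤ.* + m) a-b≡km ⟩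
    k ℤ.* + m ℤ.- + r ℤ.* + m                            ≡⟨ cong (λ x → x ℤ.* + m ℤ.- + r ℤ.* + m)
                                                                 (a≡a%ℕn+[a/ℕn]*n k τ) ⟩
    (+ r ℤ.+ (k /ℕ τ) ℤ.* + τ) ℤ.* + m ℤ.- + r ℤ.* + m  ≡⟨ collect (+ r) (k /ℕ τ) (+ τ) (+ m) ⟩
    (k /ℕ τ) ℤ.* (+ τ ℤ.* + m)                           ≡⟨ cong ((k /ℕ τ) ℤ.*_)
                                                                 (trans (sym (ℤ.pos-* τ m)) (cong +_ (sym n≡τm))) ⟩
    (k /ℕ τ) ℤ.* + n                                     ∎))
  where
  r : ℕ
  r = k %ℕ τ
  open ≡-Reasoning
  regroup : ∀ x y z → x ℤ.- (y ℤ.+ z) ≡ (x ℤ.- y) ℤ.- z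
  regroup = solve-∀
  collect : ∀ x y t u → (x ℤ.+ y ℤ.* t) ℤ.* u ℤ.- x ℤ.* u ≡ y ℤ.* (t ℤ.* u)
  collect = solve-∀

injective⇒surjective : ∀ {n} {f : Fin n → Fin n} → Injective _≡_ _≡_ f → ∀ j → ∃[ i ] f i ≡ j
injective⇒surjective {suc n} {f} f-inj j with any? (λ i → f i ≟ j)
... | yes hit  = hit
... | no  miss = contradiction (injective⇒≤ g-inj) 1+n≰n
  where
  j≢f : ∀ i → j ≢ f i
  j≢f i = miss ∘ (i ,_) ∘ sym
  g : Fin (suc n) → Fin n
  g i = punchOut (j≢f i)
  g-inj : Injective _≡_ _≡_ g
  g-inj {x} {y} = f-inj ∘ punchOut-injective (j≢f x) (j≢f y)

*≡-mod⇒*^≡-mod : ∀ {m} γ q → (γ * q) ≡ γ [mod m ] → ∀ i → (γ * q ^ i) ≡ γ [mod m ]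
*≡-mod⇒*^≡-mod γ q γq≡γ zero = ≡-mod-reflexive (*-identityʳ γ)
*≡-mod⇒*^≡-mod {m} γ q γq≡γ (suc i) = begin
  γ * (q * q ^ i)  ≡⟨ x∙yz≈y∙xz γ q (q ^ i) ⟩
  q * (γ * q ^ i)  ≈⟨ ≡-mod-*ˡ q (γ * q ^ i) γ (*≡-mod⇒*^≡-mod γ q γq≡γ i) ⟩
  q * γ            ≡⟨ *-comm q γ ⟩
  γ * q            ≈⟨ γq≡γ ⟩
  γ                ∎
  where open ≡-mod-Reasoning m

coset-no-repeat : ∀ {n q γ τ} → IsCosetSize n q γ τ → Coprime n q →
                  ∀ {i j} → i < j → j < τ → ¬ (γ * q ^ i) ≡ (γ * q ^ j) [mod n ]
coset-no-repeat {n} {q} {γ} (_ , _ , minimal) n⊥q {i} {j} i<j j<τ γqⁱ≡γqʲ =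
  minimal d (m<n⇒0<n∸m i<j) (≤-<-trans (m∸n≤m j i) j<τ)
    (≡-mod-sym γ (γ * q ^ d) (≡-mod-^-cancelˡ n⊥q i γ (γ * q ^ d) qⁱγ≡qⁱγqᵈ))
  where
  d : ℕ
  d = j ∸ i
  open ≡-mod-Reasoning n
  qⁱγ≡qⁱγqᵈ : (q ^ i * γ) ≡ (q ^ i * (γ * q ^ d)) [mod n ]
  qⁱγ≡qⁱγqᵈ = begin
    q ^ i * γ            ≡⟨ *-comm (q ^ i) γ ⟩
    γ * q ^ i            ≈⟨ γqⁱ≡γqʲ ⟩
    γ * q ^ j            ≡⟨ cong (λ k → γ * q ^ k) (sym (m+[n∸m]≡n (<⇒≤ i<j))) ⟩
    γ * q ^ (i + d)      ≡⟨ cong (γ *_) (^-distribˡ-+-* q i d) ⟩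
    γ * (q ^ i * q ^ d)  ≡⟨ x∙yz≈y∙xz γ (q ^ i) (q ^ d) ⟩
    q ^ i * (γ * q ^ d)  ∎

coset-injective : ∀ {n q γ τ} → IsCosetSize n q γ τ → Coprime n q →
                  ∀ {i j} → i < τ → j < τ → (γ * q ^ i) ≡ (γ * q ^ j) [mod n ] → i ≡ j
coset-injective {q = q} {γ} size n⊥q {i} {j} i<τ j<τ γqⁱ≡γqʲ with <-cmp i j
... | tri< i<j _ _ = contradiction γqⁱ≡γqʲ (coset-no-repeat {γ = γ} size n⊥q i<j j<τ)
... | tri≈ _ i≡j _ = i≡j
... | tri> _ _ j<i = contradiction (≡-mod-sym (γ * q ^ i) (γ * q ^ j) γqⁱ≡γqʲ)
                                   (coset-no-repeat {γ = γ} size n⊥q j<i i<τ)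

equalDifference⇒*≡-mod : ∀ {n q γ} τ .{{_ : NonZero τ}} →
                         IsCosetSize n q γ τ → EqualDifference n q γ τ → (γ * q) ≡ γ [mod n / τ ]
equalDifference⇒*≡-mod {n} {q} {γ} 1 (_ , γq¹≡γ , _) (τ∣n , _) =
  ≡-mod-∣ (γ * q) γ (m/n∣m τ∣n) (begin
    γ * q      ≡⟨ cong (γ *_) (sym (*-identityʳ q)) ⟩
    γ * q ^ 1  ≈⟨ γq¹≡γ ⟩
    γ          ∎)
  where open ≡-mod-Reasoning n
equalDifference⇒*≡-mod {n} {q} {γ} τ@(suc (suc _)) _ (τ∣n , coset⇔progression)
  with j , _ , γq≡γ+jm ← Equivalence.to (coset⇔progression (γ * q))
                           (1 , s<s z<s , ≡-mod-reflexive (cong (γ *_) (sym (*-identityʳ q)))) = begin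
    γ * q            ≈⟨ ≡-mod-∣ (γ * q) (γ + j * (n / τ)) (m/n∣m τ∣n) γq≡γ+jm ⟩
    γ + j * (n / τ)  ≈⟨ +-multiple-≡-mod γ j (n / τ) ⟩
    γ                ∎
  where open ≡-mod-Reasoning (n / τ)

module _ {n q γ τ : ℕ} .{{_ : NonZero τ}} (size : IsCosetSize n q γ τ) (n⊥q : Coprime n q)
         (τ∣n : τ ∣ n) (γq≡γ : (γ * q) ≡ γ [mod n / τ ]) where

  private
    m : ℕ
    m = n / τ

    residue : ∀ i → ∃[ r ] (r < τ × (γ * q ^ i) ≡ (γ + r * m) [mod n ])
    residue i = ≡-mod-refine (sym (m*[n/m]≡n τ∣n)) (γ * q ^ i) γ (*≡-mod⇒*^≡-mod γ q γq≡γ i)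

    r : ℕ → ℕ
    r i = proj₁ (residue i)

    r<τ : ∀ i → r i < τ
    r<τ i = proj₁ (proj₂ (residue i))

    γqⁱ≡γ+rᵢm : ∀ i → (γ * q ^ i) ≡ (γ + r i * m) [mod n ]
    γqⁱ≡γ+rᵢm i = proj₂ (proj₂ (residue i))

    index : Fin τ → Fin τ
    index i = fromℕ< (r<τ (toℕ i))

    toℕ-index : ∀ i → toℕ (index i) ≡ r (toℕ i)
    toℕ-index i = toℕ-fromℕ< (r<τ (toℕ i))

    index-injective : Injective _≡_ _≡_ index
    index-injective {i} {i′} indexᵢ≡indexᵢ′ =
      toℕ-injective (coset-injective {γ = γ} size n⊥q (toℕ<n i) (toℕ<n i′) (begin
        γ * q ^ toℕ i       ≈⟨ γqⁱ≡γ+rᵢm (toℕ i) ⟩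
        γ + r (toℕ i) * m   ≡⟨ cong (λ k → γ + k * m) rᵢ≡rᵢ′ ⟩
        γ + r (toℕ i′) * m  ≈⟨ γqⁱ≡γ+rᵢm (toℕ i′) ⟨
        γ * q ^ toℕ i′      ∎))
      where
      open ≡-mod-Reasoning n
      rᵢ≡rᵢ′ : r (toℕ i) ≡ r (toℕ i′)
      rᵢ≡rᵢ′ = trans (sym (toℕ-index i)) (trans (cong toℕ indexᵢ≡indexᵢ′) (toℕ-index i′))

    coset⇒progression : ∀ x → InCoset n q γ τ x → InProgression n γ τ x
    coset⇒progression x (i , _ , x≡γqⁱ) =
      r i , r<τ i , ≡-mod-trans x (γ * q ^ i) (γ + r i * m) x≡γqⁱ (γqⁱ≡γ+rᵢm i)

    progression⇒coset : ∀ x → InProgression n γ τ x → InCoset n q γ τ x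
    progression⇒coset x (j , j<τ , x≡γ+jm) = toℕ i , toℕ<n i , (begin
        x                  ≈⟨ x≡γ+jm ⟩
        γ + j * m          ≡⟨ cong (λ k → γ + k * m) j≡rᵢ ⟩
        γ + r (toℕ i) * m  ≈⟨ γqⁱ≡γ+rᵢm (toℕ i) ⟨
        γ * q ^ toℕ i      ∎)
      where
      open ≡-mod-Reasoning n
      preimage : ∃[ i ] index i ≡ fromℕ< j<τ
      preimage = injective⇒surjective index-injective (fromℕ< j<τ)
      i : Fin τ
      i = proj₁ preimage
      j≡rᵢ : j ≡ r (toℕ i)
      j≡rᵢ = trans (sym (toℕ-fromℕ< j<τ)) (trans (cong toℕ (sym (proj₂ preimage))) (toℕ-index i))

  *≡-mod⇒equalDifference : EqualDifference n q γ τ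
  *≡-mod⇒equalDifference = τ∣n , λ x → mk⇔ (coset⇒progression x) (progression⇒coset x)

lemma3p1 : (q n γ τ : ℕ) .{{_ : NonZero n}} .{{_ : NonZero τ}} →
    IsPrimePower q → Coprime n q → γ < n → IsCosetSize n q γ τ →
    (EqualDifference n q γ τ ⇔ (τ ∣ n × (γ * q) ≡ γ [mod n / τ ]))
lemma3p1 q n γ τ _ n⊥q _ size = mk⇔
  (λ equalDifference → proj₁ equalDifference , equalDifference⇒*≡-mod {γ = γ} τ size equalDifference)
  (λ (τ∣n , γq≡γ) → *≡-mod⇒equalDifference {γ = γ} size n⊥q τ∣n γq≡γ)
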